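{- Let $r, c, v$ be positive integers with $\max(r, c) < v < rc$. If $(r \times c, v)$ is admissible for resolvable triple arrays, then $(c \times r, v)$ is not admissible for resolvable triple arrays.
   Context: A parameter set $(r \times c, v)$ is admissible for triple arrays if $e := \frac{rc}{v}$, $\lambda_{rr} := \frac{c(e-1)}{r-1}$ and $\lambda_{cc} := \frac{r(e-1)}{c-1}$ are integers. It is admissible for resolvable triple arrays if, in addition, $\lambda_{rrc} := \frac{e(e-1)}{r-1}$ and $k := \frac{c}{e}$ are integers. (For $(c \times r, v)$ the roles of $r$ and $c$ are swapped in these formulas.) -}

module Defs where

open import Data.Nat using (ℕ; _*_; _∸_)
open import Data.Nat.Divisibility using (_∣_)
open import Data.Product using (_×_; Σ)
open import Relation.Binary.PropositionalEquality using (_≡_)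

-- "x / y is an integer" (y positive) is rendered as y ∣ x.
-- Under the theorem's hypotheses all divisors (v, r-1, c-1, e) are positive.

-- (r × c, v) is admissible for triple arrays:
--   e := rc/v, λrr := c(e-1)/(r-1), λcc := r(e-1)/(c-1) are integers.
-- The integer e = rc/v is given as a witness with r * c ≡ e * v.
AdmissibleTA : ℕ → ℕ → ℕ → Set
AdmissibleTA r c v =
  Σ ℕ λ e → (r * c ≡ e * v) × ((r ∸ 1) ∣ (c * (e ∸ 1))) × ((c ∸ 1) ∣ (r * (e ∸ 1)))

-- (r × c, v) is admissible for resolvable triple arrays: additionally
--   λrrc := e(e-1)/(r-1) and k := c/e are integers.
AdmissibleRTA : ℕ → ℕ → ℕ → Set
AdmissibleRTA r c v =
  Σ ℕ λ e → (r * c ≡ e * v) × ((r ∸ 1) ∣ (c * (e ∸ 1))) × ((c ∸ 1) ∣ (r * (e ∸ 1)))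
          × ((r ∸ 1) ∣ (e * (e ∸ 1))) × (e ∣ c)

{-# OPTIONS --safe #-}
module Submission where

open import Defs
open import Data.Nat using (ℕ; suc; _+_; _*_; _∸_; _<_; _⊔_; NonZero; >-nonZero; s≤s; z<s)
open import Relation.Nullary using (¬_)
open import Data.Nat.Properties
open import Data.Nat.Divisibility
open import Data.Product using (_,_)
open import Relation.Binary.PropositionalEquality

-- Both parameter sets share e = rc/v, and resolvability of (c × r, v) gives e ∣ r.
-- Since r ≡ 1 (mod r - 1), from r = m e we get m · e(e - 1) = r(e - 1) ≡ e - 1, so
-- r - 1 ∣ e(e - 1) forces r - 1 ∣ e - 1. But max(r, c) < v < rc gives 1 < e < r,
-- so 0 < e - 1 < r - 1.

pred∣e*pred⇒pred∣pred : ∀ {a b m} → suc a ≡ m * suc b → a ∣ suc b * b → a ∣ b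
pred∣e*pred⇒pred∣pred {a} {b} {m} r≡me a∣e[e∸1] =
  ∣m+n∣m⇒∣n (subst (a ∣_) m*e[e∸1]≡a*b+b (∣n⇒∣m*n m a∣e[e∸1])) (m∣m*n b)
  where
  open ≡-Reasoning
  m*e[e∸1]≡a*b+b : m * (suc b * b) ≡ a * b + b
  m*e[e∸1]≡a*b+b = begin
    m * (suc b * b)  ≡⟨ *-assoc m (suc b) b ⟨
    m * suc b * b    ≡⟨ cong (_* b) r≡me ⟨
    suc a * b        ≡⟨ +-comm b (a * b) ⟩
    a * b + b        ∎

proper-divisor⇒pred∤ : ∀ {r e} → e ∣ r → 1 < e → e < r → (r ∸ 1) ∤ e * (e ∸ 1)
proper-divisor⇒pred∤ (divides m r≡me) (s≤s 0<b) (s≤s b<a) a∣e[e∸1] =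
  >⇒∤ {{>-nonZero 0<b}} b<a (pred∣e*pred⇒pred∣pred {m = m} r≡me a∣e[e∸1])

1<quotient : ∀ {x e v} → x ≡ e * v → v < x → 1 < e
1<quotient {e = e} {v} x≡ev v<x =
  *-cancelʳ-< v 1 e (subst₂ _<_ (sym (*-identityˡ v)) x≡ev v<x)

quotient<factor : ∀ {r c e v} .{{_ : NonZero e}} → r * c ≡ e * v → c < v → e < r
quotient<factor {r} {c} {e} rc≡ev c<v =
  *-cancelʳ-< c e r (subst (e * c <_) (sym rc≡ev) (*-monoʳ-< e c<v))

lemma1 : (r c v : ℕ) → 0 < r → 0 < c → 0 < v → r ⊔ c < v → v < r * c →
    AdmissibleRTA r c v → ¬ AdmissibleRTA c r v
lemma1 r c v _ _ 0<v r⊔c<v v<rc (e , rc≡ev , _ , _ , r∸1∣e[e∸1] , _) (e′ , cr≡e′v , _ , _ , _ , e′∣r) =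
  proper-divisor⇒pred∤ (subst (_∣ r) e′≡e e′∣r) 1<e e<r r∸1∣e[e∸1]
  where
  e′≡e : e′ ≡ e
  e′≡e = *-cancelʳ-≡ e′ e v {{>-nonZero 0<v}} (trans (sym cr≡e′v) (trans (*-comm c r) rc≡ev))
  1<e : 1 < e
  1<e = 1<quotient rc≡ev v<rc
  e<r : e < r
  e<r = quotient<factor {{>-nonZero (<-trans z<s 1<e)}} rc≡ev (m⊔n<o⇒n<o r c r⊔c<v)
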